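{- Let $(G(n))_{n\ge1}$ be a sequence of finite graphs, $G(n)$ of order $n$, such that for all positive integers $n_1,n_2$ the disjoint union of $G(n_1)$ and $G(n_2)$ is (isomorphic to) a subgraph of $G(n_1+n_2)$. If either $\rho(G)$ or $\rho_\infty(G)$ is finite, then both are finite and $\rho(G) = \rho_\infty(G)$.
   Context: For a finite graph $G$ with vertex set $V$, $|V|=n$, and an integer $b\ge 0$, a permutation of the vertices of $G$ with $b$ blank spaces is a sequence of length $n+b$ in which every vertex of $G$ appears exactly once and the remaining $b$ entries are a blank symbol $*$. Two such sequences $\pi,\sigma$ (of the same length) are $G$-different if there is a position $i$ such that $\pi(i),\sigma(i)$ are both vertices and $\{\pi(i),\sigma(i)\}$ is an edge of $G$. $F_b(G)$ is the maximum size of a family of pairwise $G$-different permutations of the vertices of $G$ with $b$ blank spaces, and $F_\infty(G)=\sup_{b\ge0}F_b(G)$ (the maximum size of a pairwise $G$-different family with arbitrarily many blank spaces). For a sequence of graphs $(G(n))$, $\rho_b(G)=\limsup_{n\to\infty}\frac1n\log_2F_b(G(n))$ for $b\in\{0,1,2,\dots\}\cup\{\infty\}$, and $\rho(G)=\rho_0(G)$. -}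

module Defs where

open import Data.Nat using (ℕ; zero; suc; _+_; _*_; _^_; _≤_)
open import Data.Fin using (Fin; _↑ˡ_; _↑ʳ_)
open import Data.Maybe using (Maybe; just)
open import Data.Integer using (ℤ; +_; -[1+_])
open import Data.Rational.Unnormalised using (ℚᵘ; ↥_; ↧ₙ_; _<_)
open import Data.Product using (Σ; ∃; ∃-syntax; _×_)
open import Data.List using (List; length)
open import Data.List.Relation.Unary.AllPairs using (AllPairs)
open import Relation.Binary.PropositionalEquality using (_≡_)
open import Function.Definitions using (Injective)
open import Function.Bundles using (_⇔_)
open import Data.Empty using (⊥)
open import Data.Product using (_,_)

record Graph (n : ℕ) : Set₁ where
  field
    Adj     : Fin n → Fin n → Set
    sym     : ∀ {u v} → Adj u v → Adj v u
    irrefl  : ∀ {u} → Adj u u → ⊥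
open Graph public

-- A permutation of the vertices of a graph of order n with b blank
-- spaces: a sequence of length n + b (entries `just v` are vertices,
-- `nothing` is the blank *) in which every vertex appears exactly once.
IsBlankPerm : (n b : ℕ) → (Fin (n + b) → Maybe (Fin n)) → Set
IsBlankPerm n b π =
  ∀ (v : Fin n) → Σ (Fin (n + b)) λ i →
    (π i ≡ just v) × (∀ j → π j ≡ just v → j ≡ i)

BlankPerm : (n b : ℕ) → Set
BlankPerm n b = Σ (Fin (n + b) → Maybe (Fin n)) (IsBlankPerm n b)

GDifferent : ∀ {n b} → Graph n → BlankPerm n b → BlankPerm n b → Set
GDifferent {n} {b} G (π , _) (σ , _) =
  ∃[ i ] ∃[ u ] ∃[ v ] (π i ≡ just u) × (σ i ≡ just v) × Adj G u v

PairwiseGDiff : ∀ {n b} → Graph n → List (BlankPerm n b) → Set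
PairwiseGDiff G fam = AllPairs (GDifferent G) fam

-- "m ≤ 2^(r·n)" for a rational r = z/(d+1), written without reals:
--   z = +a      :  m^(d+1) ≤ 2^(a·n)
--   z = -(k+1)  :  m^(d+1) · 2^((k+1)·n) ≤ 1
BelowExpℤ : ℕ → ℕ → ℤ → ℕ → Set
BelowExpℤ m n (+ a)      d = m ^ suc d ≤ 2 ^ (a * n)
BelowExpℤ m n (-[1+ k ]) d = m ^ suc d * 2 ^ (suc k * n) ≤ 1

BelowExp : ℕ → ℕ → ℚᵘ → Set
BelowExp m n r = BelowExpℤ m n (↥ r) (ℚᵘ.denominator-1 r)

-- "F_b(G) ≤ 2^(r·n)": every pairwise G-different family of permutations
-- with b blanks has size ≤ 2^(r·n).
FbBelow : ∀ {n} → Graph n → ℕ → ℚᵘ → Set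
FbBelow {n} G b r =
  (fam : List (BlankPerm n b)) → PairwiseGDiff G fam → BelowExp (length fam) n r

FinfBelow : ∀ {n} → Graph n → ℚᵘ → Set
FinfBelow G r = ∀ b → FbBelow G b r

-- limsup_{n→∞} (1/n) log₂ F(n) ≤ q, where B n r means "F(n) ≤ 2^(r·n)":
-- for every rational r > q, eventually F(n) ≤ 2^(r·n).
LimsupLe : (ℕ → ℚᵘ → Set) → ℚᵘ → Set
LimsupLe B q = ∀ r → q < r → ∃[ N ] (∀ n → N ≤ n → B n r)

-- ρ(G) and ρ_∞(G) as upper-bound predicates (q ranges over ℚ; this
-- determines the extended real value of the limsup).
ρ≤ : ((n : ℕ) → Graph n) → ℚᵘ → Set
ρ≤ G q = LimsupLe (λ n r → FbBelow (G n) 0 r) q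

ρ∞≤ : ((n : ℕ) → Graph n) → ℚᵘ → Set
ρ∞≤ G q = LimsupLe (λ n r → FinfBelow (G n) r) q

ρFinite : ((n : ℕ) → Graph n) → Set
ρFinite G = ∃[ q ] ρ≤ G q

ρ∞Finite : ((n : ℕ) → Graph n) → Set
ρ∞Finite G = ∃[ q ] ρ∞≤ G q

-- The disjoint union of G₁ (order n₁) and G₂ (order n₂) is isomorphic to a
-- subgraph of H (order n₁ + n₂): vertices of the union are Fin n₁ ⊎ Fin n₂
-- (encoded as Fin (n₁ + n₂) via _↑ˡ_ / _↑ʳ_); an injective vertex map that
-- sends edges of each component to edges of H.
DisjUnionSubgraph : ∀ {n₁ n₂} → Graph n₁ → Graph n₂ → Graph (n₁ + n₂) → Set
DisjUnionSubgraph {n₁} {n₂} G₁ G₂ H =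
  Σ (Fin (n₁ + n₂) → Fin (n₁ + n₂)) λ f →
    Injective _≡_ _≡_ f
    × (∀ u v → Adj G₁ u v → Adj H (f (u ↑ˡ n₂)) (f (v ↑ˡ n₂)))
    × (∀ u v → Adj G₂ u v → Adj H (f (n₁ ↑ʳ u)) (f (n₁ ↑ʳ v)))

-- F₀ ≤ F_∞ gives ρ ≤ ρ_∞.  Conversely, let P be a pairwise G(n)-different
-- family of m permutations with b blanks.  Inside G(n + N) ⊇ G(n) + G(N),
-- N ≥ n + b, gluing a member of P with a permutation of G(N) (written into
-- its blanks) gives a blank-free permutation, and gluing clashing families
-- gives a clashing family of product size.  Iterating yields m^k permutations
-- of G(k·n + n + b), so F₀(G(N)) ≤ 2^(rN) for large N forces
-- m^k ≤ 2^(r(n+b)) · (2^(rn))^k for large k, whence m ≤ 2^(rn) by Bernoulli.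
module Submission where

open import Defs
  using ( Graph; Adj; IsBlankPerm; BlankPerm; GDifferent; DisjUnionSubgraph; FbBelow
        ; ρ≤; ρ∞≤; ρFinite; ρ∞Finite )
open import Data.Nat using (ℕ; zero; suc; _+_; _*_; _^_; _≤_; s≤s; NonZero; _≤?_; >-nonZero⁻¹)
open import Data.Nat.Properties
open import Data.Nat.Tactic.RingSolver using (solve-∀)
open import Data.Integer using (-[1+_]) renaming (+_ to ℤ+_)
open import Data.Rational.Unnormalised using (ℚᵘ; mkℚᵘ)
open import Data.Fin using (Fin; zero; suc; cast; _↑ˡ_; _↑ʳ_; splitAt)
import Data.Fin.Properties as Fin
open import Data.Maybe using (Maybe; just; nothing)
import Data.Maybe as Maybe
open import Data.List
  using (List; []; _∷_; _++_; length; map; lookup; tabulate; catMaybes; allFin; cartesianProductWith)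
open import Data.List.Properties using (length-++; length-map; length-tabulate)
open import Data.List.Relation.Unary.All as All using (All; []; _∷_)
import Data.List.Relation.Unary.All.Properties as All
open import Data.List.Relation.Unary.AllPairs as AllPairs using (AllPairs; []; _∷_)
import Data.List.Relation.Unary.AllPairs.Properties as AllPairs
open import Data.List.Relation.Unary.Any as Any using (here; there)
open import Data.List.Relation.Unary.Any.Properties using (lookup-index)
open import Data.List.Relation.Unary.Unique.Propositional using (Unique)
import Data.List.Relation.Unary.Unique.Propositional.Properties as Unique
open import Data.List.Relation.Binary.Disjoint.Propositional using (Disjoint)
open import Data.List.Relation.Binary.Permutation.Propositional
  using (_↭_; prep; ↭-refl; ↭-trans; ↭-sym; ↭⇒↭ₛ)
open import Data.List.Relation.Binary.Permutation.Propositional.Properties using (shift; ↭-length)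
import Data.List.Relation.Binary.Permutation.Setoid.Properties as Permutationₛ
open import Data.List.Membership.Propositional using (_∈_; _∉_)
open import Data.List.Membership.Propositional.Properties
  using (∈-lookup; ∈-tabulate⁺; ∈-tabulate⁻; ∈-map⁻)
open import Data.Product using (Σ; ∃; ∃₂; _×_; _,_; proj₁; proj₂)
open import Data.Sum using (_⊎_; inj₁; inj₂)
open import Data.Empty using (⊥; ⊥-elim)
open import Function using (_∘_)
open import Function.Bundles using (_⇔_; mk⇔)
open import Function.Definitions using (Injective)
open import Relation.Nullary using (yes; no)
open import Relation.Binary.PropositionalEquality
  using (_≡_; _≢_; refl; sym; trans; cong; cong₂; subst; subst₂; setoid; module ≡-Reasoning)

-- `Clash R xs ys`: at some position present in both lists the entries are
-- R-related.  For R the adjacency of a graph this is G-difference of sequences.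
data Clash {A : Set} (R : A → A → Set) : List A → List A → Set where
  head-clash : ∀ {x y xs ys} → R x y → Clash R (x ∷ xs) (y ∷ ys)
  tail-clash : ∀ {x y xs ys} → Clash R xs ys → Clash R (x ∷ xs) (y ∷ ys)

data BothJust {A : Set} (E : A → A → Set) : Maybe A → Maybe A → Set where
  just : ∀ {u v} → E u v → BothJust E (just u) (just v)

clash-map : ∀ {A B : Set} {R : A → A → Set} {S : B → B → Set} (f : A → B) →
  (∀ {x y} → R x y → S (f x) (f y)) →
  ∀ {xs ys} → Clash R xs ys → Clash S (map f xs) (map f ys)
clash-map f hom (head-clash r) = head-clash (hom r)
clash-map f hom (tail-clash c) = tail-clash (clash-map f hom c)

module _ {A : Set} where

  ∈-catMaybes⁺ : ∀ {v} {xs : List (Maybe A)} → just v ∈ xs → v ∈ catMaybes xs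
  ∈-catMaybes⁺ {xs = just x  ∷ xs} (here refl) = here refl
  ∈-catMaybes⁺ {xs = just x  ∷ xs} (there p)   = there (∈-catMaybes⁺ p)
  ∈-catMaybes⁺ {xs = nothing ∷ xs} (there p)   = ∈-catMaybes⁺ p

  ∈-catMaybes⁻ : ∀ {v} (xs : List (Maybe A)) → v ∈ catMaybes xs → just v ∈ xs
  ∈-catMaybes⁻ (just x  ∷ xs) (here refl) = here refl
  ∈-catMaybes⁻ (just x  ∷ xs) (there p)   = there (∈-catMaybes⁻ xs p)
  ∈-catMaybes⁻ (nothing ∷ xs) p           = there (∈-catMaybes⁻ xs p)

  unique-catMaybes-tail : ∀ x xs → Unique {A = A} (catMaybes (x ∷ xs)) → Unique {A = A} (catMaybes xs)
  unique-catMaybes-tail (just u) xs (_ ∷ u!) = u!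
  unique-catMaybes-tail nothing  xs u!       = u!

  unique-catMaybes-head : ∀ x xs {v} → Unique {A = A} (catMaybes (x ∷ xs)) → x ≡ just v → v ∉ catMaybes xs
  unique-catMaybes-head (just u) xs (u∉ ∷ _) refl p = All.lookup u∉ p refl

catMaybes-map : ∀ {A B : Set} (g : A → B) (xs : List (Maybe A)) →
  catMaybes (map (Maybe.map g) xs) ≡ map g (catMaybes xs)
catMaybes-map g []            = refl
catMaybes-map g (just x  ∷ xs) = cong (g x ∷_) (catMaybes-map g xs)
catMaybes-map g (nothing ∷ xs) = catMaybes-map g xs

catMaybes-map-just : ∀ {A : Set} (xs : List A) → catMaybes (map just xs) ≡ xs
catMaybes-map-just []       = refl
catMaybes-map-just (x ∷ xs) = cong (x ∷_) (catMaybes-map-just xs)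

module _ {A : Set} where

  fill : List (Maybe A) → List A → List A
  fill []            s       = s
  fill (just v ∷ a)  s       = v ∷ fill a s
  fill (nothing ∷ a) []      = fill a []
  fill (nothing ∷ a) (x ∷ s) = x ∷ fill a s

  fill-↭ : ∀ a s → fill a s ↭ catMaybes a ++ s
  fill-↭ []            s       = ↭-refl
  fill-↭ (just v ∷ a)  s       = prep v (fill-↭ a s)
  fill-↭ (nothing ∷ a) []      = fill-↭ a []
  fill-↭ (nothing ∷ a) (x ∷ s) =
    ↭-trans (prep x (fill-↭ a s)) (↭-sym (shift x (catMaybes a) s))

  fill-length : ∀ a s → length (fill a s) ≡ length (catMaybes a) + length s
  fill-length a s = trans (↭-length (fill-↭ a s)) (length-++ (catMaybes a))

  fill-unique : ∀ a s → Unique (catMaybes a) → Unique s → Disjoint (catMaybes a) s →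
    Unique (fill a s)
  fill-unique a s ua us disj = Permutationₛ.Unique-resp-↭ (setoid A)
    (↭⇒↭ₛ (↭-sym (fill-↭ a s))) (Unique.++⁺ ua us disj)

  fill-∷ : ∀ x a s → length (x ∷ a) ≤ length s →
    ∃₂ λ h s′ → fill (x ∷ a) s ≡ h ∷ fill a s′ × length a ≤ length s′
  fill-∷ (just v) a s       l       = v , s , refl , <⇒≤ l
  fill-∷ nothing  a (y ∷ s) (s≤s l) = y , s , refl , l

  clash-fillˡ : ∀ {E : A → A → Set} {a a′} s s′ → length a ≤ length s → length a′ ≤ length s′ →
    Clash (BothJust E) a a′ → Clash E (fill a s) (fill a′ s′)
  clash-fillˡ s s′ l l′ (head-clash (just e)) = head-clash e
  clash-fillˡ {a = x ∷ a} {y ∷ a′} s s′ l l′ (tail-clash c)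
    with fill-∷ x a s l | fill-∷ y a′ s′ l′
  ... | _ , s₁ , eq , l₁ | _ , s₁′ , eq′ , l₁′ rewrite eq | eq′ =
    tail-clash (clash-fillˡ s₁ s₁′ l₁ l₁′ c)

  clash-fillʳ : ∀ {E : A → A → Set} a {s s′} → Clash E s s′ → Clash E (fill a s) (fill a s′)
  clash-fillʳ []            c              = c
  clash-fillʳ (just v ∷ a)  c              = tail-clash (clash-fillʳ a c)
  clash-fillʳ (nothing ∷ a) (head-clash e) = head-clash e
  clash-fillʳ (nothing ∷ a) (tail-clash c) = tail-clash (clash-fillʳ a c)

lookup-injective : ∀ {A : Set} {l : List A} → Unique l → Injective _≡_ _≡_ (lookup l)
lookup-injective {l = x ∷ l} (x∉l ∷ u) {zero}  {zero}  e = refl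
lookup-injective {l = x ∷ l} (x∉l ∷ u) {zero}  {suc j} e = ⊥-elim (All.lookup x∉l (∈-lookup j) e)
lookup-injective {l = x ∷ l} (x∉l ∷ u) {suc i} {zero}  e = ⊥-elim (All.lookup x∉l (∈-lookup i) (sym e))
lookup-injective {l = x ∷ l} (x∉l ∷ u) {suc i} {suc j} e = cong suc (lookup-injective u e)

module _ {N : ℕ} where
  open import Data.List.Membership.DecPropositional (Fin._≟_ {N}) using (_∈?_)

  unique⇒length≤ : {l : List (Fin N)} → Unique l → length l ≤ N
  unique⇒length≤ u = Fin.injective⇒≤ (lookup-injective u)

  complete⇒length≥ : {l : List (Fin N)} → (∀ v → v ∈ l) → N ≤ length l
  complete⇒length≥ {l} complete = Fin.injective⇒≤ index-injective
    where
    index-injective : Injective _≡_ _≡_ (λ v → Any.index (complete v))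
    index-injective {v} {w} e = trans (lookup-index (complete v))
      (trans (cong (lookup l) e) (sym (lookup-index (complete w))))

  complete⇒length : {l : List (Fin N)} → Unique l → (∀ v → v ∈ l) → length l ≡ N
  complete⇒length u complete = ≤-antisym (unique⇒length≤ u) (complete⇒length≥ complete)

  length⇒complete : {l : List (Fin N)} → Unique l → length l ≡ N → ∀ v → v ∈ l
  length⇒complete {l} u len v with v ∈? l
  ... | yes v∈l = v∈l
  ... | no  v∉l = ⊥-elim (1+n≰n (subst (λ k → suc k ≤ N) len
                    (unique⇒length≤ (All.¬Any⇒All¬ l v∉l ∷ u))))

-- A sequence with blanks of length m can also be given as a function
-- π : Fin m → Maybe A (the form used by BlankPerm); its list form is
-- `tabulate π`.
module _ {A : Set} where

  vertices : ∀ {m} → (Fin m → Maybe A) → List A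
  vertices π = catMaybes (tabulate π)

  vertices-∈⁺ : ∀ {m} (π : Fin m → Maybe A) {i v} → π i ≡ just v → v ∈ vertices π
  vertices-∈⁺ π {i} e = ∈-catMaybes⁺ (subst (_∈ tabulate π) e (∈-tabulate⁺ i))

  vertices-∈⁻ : ∀ {m} (π : Fin m → Maybe A) {v} → v ∈ vertices π → ∃ λ i → π i ≡ just v
  vertices-∈⁻ π p with i , e ← ∈-tabulate⁻ (∈-catMaybes⁻ (tabulate π) p) = i , sym e

  JustInjective : ∀ {m} → (Fin m → Maybe A) → Set
  JustInjective π = ∀ {i j v} → π i ≡ just v → π j ≡ just v → i ≡ j

  vertices-unique⁺ : ∀ {m} (π : Fin m → Maybe A) → JustInjective π → Unique {A = A} (vertices π)
  vertices-unique⁺ {zero}  π inj = []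
  vertices-unique⁺ {suc m} π inj with π zero in π₀
  ... | nothing = vertices-unique⁺ (π ∘ suc) (λ p q → Fin.suc-injective (inj p q))
  ... | just u  =
    All.¬Any⇒All¬ _ u∉ ∷ vertices-unique⁺ (π ∘ suc) (λ p q → Fin.suc-injective (inj p q))
    where
    u∉ : u ∉ vertices (π ∘ suc)
    u∉ p with i , πi ← vertices-∈⁻ (π ∘ suc) p = Fin.0≢1+n (inj π₀ πi)

  vertices-unique⁻ : ∀ {m} (π : Fin m → Maybe A) → Unique {A = A} (vertices π) → JustInjective π
  vertices-unique⁻ π u! {zero}  {zero}  p q = refl
  vertices-unique⁻ π u! {zero}  {suc j} p q =
    ⊥-elim (unique-catMaybes-head (π zero) (tabulate (π ∘ suc)) u! p (vertices-∈⁺ (π ∘ suc) q))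
  vertices-unique⁻ π u! {suc i} {zero}  p q =
    ⊥-elim (unique-catMaybes-head (π zero) (tabulate (π ∘ suc)) u! q (vertices-∈⁺ (π ∘ suc) p))
  vertices-unique⁻ π u! {suc i} {suc j} p q =
    cong suc (vertices-unique⁻ (π ∘ suc) (unique-catMaybes-tail (π zero) (tabulate (π ∘ suc)) u!) p q)

  ClashAt : ∀ {m} → (A → A → Set) → (Fin m → Maybe A) → (Fin m → Maybe A) → Set
  ClashAt E π σ = ∃ λ i → ∃₂ λ u v → (π i ≡ just u) × (σ i ≡ just v) × E u v

  clash-tabulate⁺ : ∀ {m} {E : A → A → Set} (π σ : Fin m → Maybe A) →
    ClashAt E π σ → Clash (BothJust E) (tabulate π) (tabulate σ)
  clash-tabulate⁺ π σ (zero  , u , v , p , q , e) =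
    head-clash (subst₂ (BothJust _) (sym p) (sym q) (just e))
  clash-tabulate⁺ π σ (suc i , u , v , p , q , e) =
    tail-clash (clash-tabulate⁺ (π ∘ suc) (σ ∘ suc) (i , u , v , p , q , e))

  clash-tabulate⁻ : ∀ {m} {E : A → A → Set} (π σ : Fin m → Maybe A) →
    Clash (BothJust E) (tabulate π) (tabulate σ) → ClashAt E π σ
  clash-tabulate⁻ {suc m} π σ (head-clash b) = zero , bothJust⁻ b
    where
    bothJust⁻ : ∀ {E x y} → BothJust E x y → ∃₂ λ u v → (x ≡ just u) × (y ≡ just v) × E u v
    bothJust⁻ (just e) = _ , _ , refl , refl , e
  clash-tabulate⁻ {suc m} π σ (tail-clash c)
    with i , rest ← clash-tabulate⁻ (π ∘ suc) (σ ∘ suc) c = suc i , rest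

  tabulate-lookup-cast : ∀ {m} (xs : List A) (eq : m ≡ length xs) →
    tabulate (lookup xs ∘ cast eq) ≡ xs
  tabulate-lookup-cast {zero}  []       eq = refl
  tabulate-lookup-cast {suc m} (x ∷ xs) eq = cong (x ∷_) (tabulate-lookup-cast xs (suc-injective eq))

record BlankSeq (n b : ℕ) : Set where
  field
    entries  : List (Maybe (Fin n))
    length≡  : length entries ≡ n + b
    unique   : Unique (catMaybes entries)
    complete : ∀ v → v ∈ catMaybes entries
open BlankSeq

record Perm (N : ℕ) : Set where
  field
    order   : List (Fin N)
    unique  : Unique order
    length≡ : length order ≡ N
open Perm

SeqClash : ∀ {n b} → Graph n → BlankSeq n b → BlankSeq n b → Set
SeqClash G a a′ = Clash (BothJust (Adj G)) (entries a) (entries a′)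

PermClash : ∀ {N} → Graph N → Perm N → Perm N → Set
PermClash G p q = Clash (Adj G) (order p) (order q)

toSeq : ∀ {n b} → BlankPerm n b → BlankSeq n b
toSeq (π , isPerm) = record
  { entries  = tabulate π
  ; length≡  = length-tabulate π
  ; unique   = vertices-unique⁺ π justInjective
  ; complete = λ v → vertices-∈⁺ π (proj₁ (proj₂ (isPerm v)))
  }
  where
  justInjective : JustInjective π
  justInjective {i} {j} {v} p q with _ , _ , only ← isPerm v = trans (only i p) (sym (only j q))

toSeq-clash : ∀ {n b} (G : Graph n) (x y : BlankPerm n b) →
  GDifferent G x y → SeqClash G (toSeq x) (toSeq y)
toSeq-clash G (π , _) (σ , _) = clash-tabulate⁺ π σ

positions : ∀ {n b} → BlankSeq n b → Fin (n + b) → Maybe (Fin n)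
positions a = lookup (entries a) ∘ cast (sym (length≡ a))

positions-entries : ∀ {n b} (a : BlankSeq n b) → tabulate (positions a) ≡ entries a
positions-entries a = tabulate-lookup-cast (entries a) (sym (length≡ a))

fromSeq : ∀ {n b} → BlankSeq n b → BlankPerm n b
fromSeq {n} {b} a = π , isPerm
  where
  π : Fin (n + b) → Maybe (Fin n)
  π = positions a
  π-complete : ∀ v → v ∈ vertices π
  π-complete v = subst (λ xs → v ∈ catMaybes xs) (sym (positions-entries a)) (complete a v)
  π-injective : JustInjective π
  π-injective = vertices-unique⁻ π (subst (Unique ∘ catMaybes) (sym (positions-entries a)) (unique a))
  isPerm : IsBlankPerm n b π
  isPerm v with i , πi ← vertices-∈⁻ π (π-complete v) = i , πi , λ j πj → π-injective πj πi

fromSeq-clash : ∀ {n b} (G : Graph n) (a a′ : BlankSeq n b) →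
  SeqClash G a a′ → GDifferent G (fromSeq a) (fromSeq a′)
fromSeq-clash G a a′ c = clash-tabulate⁻ (positions a) (positions a′)
  (subst₂ (Clash (BothJust (Adj G))) (sym (positions-entries a)) (sym (positions-entries a′)) c)

fromPerm : ∀ {N} → Perm N → BlankSeq N 0
fromPerm {N} p = record
  { entries  = map just (order p)
  ; length≡  = trans (length-map just (order p)) (trans (length≡ p) (sym (+-identityʳ N)))
  ; unique   = subst Unique (sym (catMaybes-map-just (order p))) (unique p)
  ; complete = λ v → subst (v ∈_) (sym (catMaybes-map-just (order p)))
                       (length⇒complete (unique p) (length≡ p) v)
  }

fromPerm-clash : ∀ {N} (G : Graph N) (p q : Perm N) →
  PermClash G p q → SeqClash G (fromPerm p) (fromPerm q)
fromPerm-clash G p q = clash-map just just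

identity : ∀ N → Perm N
identity N = record
  { order = allFin N ; unique = Unique.allFin⁺ N ; length≡ = length-tabulate (λ i → i) }

module _ {A B C : Set} (f : A → B → C) where

  length-cartesianProductWith : ∀ xs ys →
    length (cartesianProductWith f xs ys) ≡ length xs * length ys
  length-cartesianProductWith []       ys = refl
  length-cartesianProductWith (x ∷ xs) ys = begin
    length (map (f x) ys ++ cartesianProductWith f xs ys)   ≡⟨ length-++ (map (f x) ys) ⟩
    length (map (f x) ys) + length (cartesianProductWith f xs ys)
      ≡⟨ cong₂ _+_ (length-map (f x) ys) (length-cartesianProductWith xs ys) ⟩
    length ys + length xs * length ys ∎
    where open ≡-Reasoning

  allPairs-cartesianProductWith⁺ : ∀ {R : A → A → Set} {S : B → B → Set} {Q : C → C → Set} →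
    (∀ {x y y′} → S y y′ → Q (f x y) (f x y′)) →
    (∀ {x x′ y y′} → R x x′ → Q (f x y) (f x′ y′)) →
    ∀ {xs ys} → AllPairs R xs → AllPairs S ys → AllPairs Q (cartesianProductWith f xs ys)
  allPairs-cartesianProductWith⁺ sameRow diffRow {[]} [] sys = []
  allPairs-cartesianProductWith⁺ sameRow diffRow {x ∷ xs} {ys} (rx ∷ rxs) sys =
    AllPairs.++⁺ (AllPairs.map⁺ (AllPairs.map sameRow sys))
      (allPairs-cartesianProductWith⁺ sameRow diffRow rxs sys)
      (All.map⁺ (All.tabulate λ _ → All.cartesianProductWith⁺ (setoid A) (setoid B) f xs ys
         λ x′∈xs _ → diffRow (All.lookup rx x′∈xs)))

-- A blank sequence a for G₁ and a
-- permutation p of G₂ are renamed into vertices of H, and the blanks of a are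
-- filled with p.  When p is at least as long as a, clashes of either
-- component persist, so products of clashing families stay clashing in H.
module Glue {n₁ n₂ b} (G₁ : Graph n₁) (G₂ : Graph n₂) (H : Graph (n₁ + n₂))
            (emb : DisjUnionSubgraph G₁ G₂ H) (room : n₁ + b ≤ n₂) where

  f : Fin (n₁ + n₂) → Fin (n₁ + n₂)
  f = proj₁ emb

  ι₁ : Fin n₁ → Fin (n₁ + n₂)
  ι₁ u = f (u ↑ˡ n₂)

  ι₂ : Fin n₂ → Fin (n₁ + n₂)
  ι₂ v = f (n₁ ↑ʳ v)

  ι₁-injective : ∀ {u v} → ι₁ u ≡ ι₁ v → u ≡ v
  ι₁-injective e = Fin.↑ˡ-injective n₂ _ _ (proj₁ (proj₂ emb) e)

  ι₂-injective : ∀ {u v} → ι₂ u ≡ ι₂ v → u ≡ v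
  ι₂-injective e = Fin.↑ʳ-injective n₁ _ _ (proj₁ (proj₂ emb) e)

  ι₁-edge : ∀ {u v} → Adj G₁ u v → Adj H (ι₁ u) (ι₁ v)
  ι₁-edge = proj₁ (proj₂ (proj₂ emb)) _ _

  ι₂-edge : ∀ {u v} → Adj G₂ u v → Adj H (ι₂ u) (ι₂ v)
  ι₂-edge = proj₂ (proj₂ (proj₂ emb)) _ _

  ι-disjoint : ∀ u v → ι₁ u ≢ ι₂ v
  ι-disjoint u v e = inj₁≢inj₂ (begin
      inj₁ u                ≡⟨ Fin.splitAt-↑ˡ n₁ u n₂ ⟨
      splitAt n₁ (u ↑ˡ n₂)  ≡⟨ cong (splitAt n₁) (proj₁ (proj₂ emb) e) ⟩
      splitAt n₁ (n₁ ↑ʳ v)  ≡⟨ Fin.splitAt-↑ʳ n₁ n₂ v ⟩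
      inj₂ v                ∎)
    where
    open ≡-Reasoning
    inj₁≢inj₂ : inj₁ {B = Fin n₂} u ≢ inj₂ v
    inj₁≢inj₂ ()

  frame : BlankSeq n₁ b → List (Maybe (Fin (n₁ + n₂)))
  frame a = map (Maybe.map ι₁) (entries a)

  filler : Perm n₂ → List (Fin (n₁ + n₂))
  filler p = map ι₂ (order p)

  frame-vertices : ∀ a → catMaybes (frame a) ≡ map ι₁ (catMaybes (entries a))
  frame-vertices a = catMaybes-map ι₁ (entries a)

  frame≤filler : ∀ a p → length (frame a) ≤ length (filler p)
  frame≤filler a p = subst₂ _≤_
    (sym (trans (length-map _ (entries a)) (length≡ a)))
    (sym (trans (length-map ι₂ (order p)) (length≡ p))) room

  -- The glued permutation: the vertices of a and of p are distinct vertices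
  -- of H, n₁ + n₂ in total.
  glue : BlankSeq n₁ b → Perm n₂ → Perm (n₁ + n₂)
  glue a p = record
    { order   = fill (frame a) (filler p)
    ; unique  = fill-unique (frame a) (filler p)
        (subst Unique (sym (frame-vertices a)) (Unique.map⁺ ι₁-injective (unique a)))
        (Unique.map⁺ ι₂-injective (unique p))
        disjoint
    ; length≡ = begin
        length (fill (frame a) (filler p))                ≡⟨ fill-length (frame a) (filler p) ⟩
        length (catMaybes (frame a)) + length (filler p)
          ≡⟨ cong₂ _+_ vertex-count (length-map ι₂ (order p)) ⟩
        n₁ + length (order p)                             ≡⟨ cong (n₁ +_) (length≡ p) ⟩
        n₁ + n₂                                           ∎
    }
    where
    open ≡-Reasoning
    vertex-count : length (catMaybes (frame a)) ≡ n₁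
    vertex-count = begin
      length (catMaybes (frame a))             ≡⟨ cong length (frame-vertices a) ⟩
      length (map ι₁ (catMaybes (entries a)))  ≡⟨ length-map ι₁ (catMaybes (entries a)) ⟩
      length (catMaybes (entries a))           ≡⟨ complete⇒length (unique a) (complete a) ⟩
      n₁                                       ∎
    disjoint : Disjoint (catMaybes (frame a)) (filler p)
    disjoint (w∈frame , w∈filler)
      with u , _ , refl ← ∈-map⁻ ι₁ (subst (_ ∈_) (frame-vertices a) w∈frame)
         | v , _ , w≡ι₂v ← ∈-map⁻ ι₂ w∈filler = ι-disjoint u v w≡ι₂v

  glue-clashˡ : ∀ {a a′} p p′ → SeqClash G₁ a a′ → PermClash H (glue a p) (glue a′ p′)
  glue-clashˡ {a} {a′} p p′ c =
    clash-fillˡ (filler p) (filler p′) (frame≤filler a p) (frame≤filler a′ p′)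
      (clash-map (Maybe.map ι₁) (λ { (just e) → just (ι₁-edge e) }) c)

  glue-clashʳ : ∀ a {p p′} → PermClash G₂ p p′ → PermClash H (glue a p) (glue a p′)
  glue-clashʳ a c = clash-fillʳ (frame a) (clash-map ι₂ ι₂-edge c)

  glue-family : ∀ {P F} → AllPairs (SeqClash G₁) P → AllPairs (PermClash G₂) F →
    AllPairs (PermClash H) (cartesianProductWith glue P F)
  glue-family = allPairs-cartesianProductWith⁺ glue
    (λ {a} {p} {p′} → glue-clashʳ a {p} {p′})
    (λ {a} {a′} {p} {p′} → glue-clashˡ {a} {a′} p p′)

-- Given a clashing family P of blank sequences for G n
-- (n ≥ 1), G (T k) has a clashing family of |P|^k permutations, where
-- T 0 = n + b and T (k+1) = n + T k, i.e. T k = k·n + (n + b).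
module TensorPower (G : (n : ℕ) → Graph n)
  (superadditive : ∀ n₁ n₂ → DisjUnionSubgraph (G (suc n₁)) (G (suc n₂)) (G (suc n₁ + suc n₂)))
  {n′ b : ℕ} (P : List (BlankSeq (suc n′) b)) (P-clash : AllPairs (SeqClash (G (suc n′))) P) where

  n : ℕ
  n = suc n′

  T : ℕ → ℕ
  T zero    = n + b
  T (suc k) = n + T k

  T-closed : ∀ k → T k ≡ k * n + (n + b)
  T-closed zero    = refl
  T-closed (suc k) = trans (cong (n +_) (T-closed k)) (sym (+-assoc n (k * n) (n + b)))

  room : ∀ k → n + b ≤ T k
  room k = subst (n + b ≤_) (sym (T-closed k)) (m≤n+m (n + b) (k * n))

  Family : ℕ → ℕ → Set
  Family N s = Σ (List (Perm N)) λ F → length F ≡ s × AllPairs (PermClash (G N)) F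

  extend : ∀ N {s} → n + b ≤ N → Family N s → Family (n + N) (length P * s)
  extend (suc m) r@(s≤s _) (F , F-length , F-clash) =
    cartesianProductWith glue P F ,
    trans (length-cartesianProductWith glue P F) (cong (length P *_) F-length) ,
    glue-family P-clash F-clash
    where open Glue (G n) (G (suc m)) (G (n + suc m)) (superadditive n′ m) r

  power : ∀ k → Family (T k) (length P ^ k)
  power zero    = identity (T zero) ∷ [] , refl , [] ∷ []
  power (suc k) = extend (T k) (room k) (power k)

-- Bernoulli's inequality (1 + 1/y)^k ≥ 1 + k/y, with denominators cleared.
bernoulli : ∀ y k → y ^ k * (y + k) ≤ suc y ^ k * y
bernoulli y zero    = ≤-reflexive (cong (1 *_) (+-identityʳ y))
bernoulli y (suc k) = begin
  y ^ suc k * (y + suc k)          ≡⟨ expand (y ^ k) y k ⟩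
  y ^ k * (y + y * (y + k))        ≤⟨ *-monoʳ-≤ (y ^ k) (+-monoˡ-≤ (y * (y + k)) (m≤m+n y k)) ⟩
  y ^ k * ((y + k) + y * (y + k))  ≡⟨ regroup (y ^ k) y k ⟩
  y ^ k * (y + k) * suc y          ≤⟨ *-monoˡ-≤ (suc y) (bernoulli y k) ⟩
  suc y ^ k * y * suc y            ≡⟨ swap (suc y ^ k) y ⟩
  suc y ^ suc k * y                ∎
  where
  open ≤-Reasoning
  expand : ∀ p y k → y * p * (y + suc k) ≡ p * (y + y * (y + k))
  expand = solve-∀
  regroup : ∀ p y k → p * ((y + k) + y * (y + k)) ≡ p * (y + k) * suc y
  regroup = solve-∀
  swap : ∀ q y → q * y * suc y ≡ suc y * q * y
  swap = solve-∀

-- A constant factor cannot sustain exponential growth: if M^k ≤ C·y^k for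
-- all large k then M ≤ y.  (Otherwise Bernoulli gives y + k ≤ C·y for all
-- large k.)
exponential-bound : ∀ M y C N₀ .{{_ : NonZero y}} →
  (∀ k → N₀ ≤ k → M ^ k ≤ C * y ^ k) → M ≤ y
exponential-bound M y C N₀ bound with M ≤? y
... | yes M≤y = M≤y
... | no  M≰y = ⊥-elim (≤⇒≯ y+Cy≤Cy (m<n+m (C * y) (>-nonZero⁻¹ y)))
  where
  k : ℕ
  k = C * y + N₀
  N₀≤k : N₀ ≤ k
  N₀≤k = m≤n+m N₀ (C * y)
  y+k≤Cy : y + k ≤ C * y
  y+k≤Cy = *-cancelˡ-≤ (y ^ k) {{m^n≢0 y k}} (begin
    y ^ k * (y + k)   ≤⟨ bernoulli y k ⟩
    suc y ^ k * y     ≤⟨ *-monoˡ-≤ y (≤-trans (^-monoˡ-≤ k (≰⇒> M≰y)) (bound k N₀≤k)) ⟩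
    C * y ^ k * y     ≡⟨ regroup C (y ^ k) y ⟩
    y ^ k * (C * y)   ∎)
    where
    open ≤-Reasoning
    regroup : ∀ c p y → c * p * y ≡ p * (c * y)
    regroup = solve-∀
  y+Cy≤Cy : y + C * y ≤ C * y
  y+Cy≤Cy = ≤-trans (+-monoʳ-≤ y (m≤m+n (C * y) N₀)) y+k≤Cy

-- A one-member family violates any bound 2^(-(e+1)) < 1; this rules out
-- negative rates.
no-negative-rate : ∀ D e → 1 ^ D * 2 ^ suc e ≤ 1 → ⊥
no-negative-rate D e le = 1+n≰n (≤-trans (*-monoʳ-≤ 2 (m^n>0 2 e))
  (subst (_≤ 1) (trans (cong (_* 2 ^ suc e) (^-zeroˡ D)) (*-identityˡ (2 ^ suc e))) le))

power-split : ∀ A n b k → 2 ^ (A * (k * n + (n + b))) ≡ 2 ^ (A * (n + b)) * (2 ^ (A * n)) ^ k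
power-split A n b k = begin
  2 ^ (A * (k * n + (n + b)))              ≡⟨ cong (2 ^_) (distrib A k n (n + b)) ⟩
  2 ^ (A * n * k + A * (n + b))            ≡⟨ ^-distribˡ-+-* 2 (A * n * k) (A * (n + b)) ⟩
  2 ^ (A * n * k) * 2 ^ (A * (n + b))      ≡⟨ cong (_* 2 ^ (A * (n + b))) (^-*-assoc 2 (A * n) k) ⟨
  (2 ^ (A * n)) ^ k * 2 ^ (A * (n + b))    ≡⟨ *-comm ((2 ^ (A * n)) ^ k) (2 ^ (A * (n + b))) ⟩
  2 ^ (A * (n + b)) * (2 ^ (A * n)) ^ k    ∎
  where
  open ≡-Reasoning
  distrib : ∀ A k n c → A * (k * n + c) ≡ A * n * k + A * c
  distrib = solve-∀

power-swap : ∀ m D k → (m ^ D) ^ k ≡ (m ^ k) ^ D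
power-swap m D k =
  trans (^-*-assoc m D k) (trans (cong (m ^_) (*-comm D k)) (sym (^-*-assoc m k D)))

-- The heart of the theorem: if clashing families of permutations of G N are
-- bounded by 2^((A/D)·N) for all large N, then so are families with any
-- number b of blanks, at every order n ≥ 1.  The tensor powers of a family
-- of size m give families of size m^k at orders T k = k·n + (n + b), so
-- (m^D)^k ≤ 2^(A(n+b)) · (2^(A n))^k for all large k, whence m^D ≤ 2^(A n).
blank-bound⁺ : (G : (n : ℕ) → Graph n)
  (superadditive : ∀ n₁ n₂ → DisjUnionSubgraph (G (suc n₁)) (G (suc n₂)) (G (suc n₁ + suc n₂)))
  (N₀ A D′ : ℕ) → (∀ N → N₀ ≤ N → FbBelow (G N) 0 (mkℚᵘ (ℤ+ A) D′)) →
  ∀ n′ b → FbBelow (G (suc n′)) b (mkℚᵘ (ℤ+ A) D′)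
blank-bound⁺ G superadditive N₀ A D′ below n′ b fam fam-diff =
  exponential-bound (length fam ^ D) (2 ^ (A * n)) (2 ^ (A * (n + b))) N₀ {{m^n≢0 2 (A * n)}}
    λ k N₀≤k → begin
      (length fam ^ D) ^ k                   ≡⟨ power-swap (length fam) D k ⟩
      (length fam ^ k) ^ D                   ≡⟨ cong (_^ D) (family-length k) ⟨
      length (family k) ^ D                  ≤⟨ below (T k) (N₀≤T N₀≤k) (family k) (family-diff k) ⟩
      2 ^ (A * T k)                          ≡⟨ cong (λ N → 2 ^ (A * N)) (T-closed k) ⟩
      2 ^ (A * (k * n + (n + b)))            ≡⟨ power-split A n b k ⟩
      2 ^ (A * (n + b)) * (2 ^ (A * n)) ^ k  ∎
  where
  open ≤-Reasoning
  D : ℕ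
  D = suc D′
  open TensorPower G superadditive (map toSeq fam)
    (AllPairs.map⁺ (AllPairs.map (λ {x} {y} → toSeq-clash (G (suc n′)) x y) fam-diff))

  family : ∀ k → List (BlankPerm (T k) 0)
  family k = map (fromSeq ∘ fromPerm) (proj₁ (power k))

  family-length : ∀ k → length (family k) ≡ length fam ^ k
  family-length k = begin-equality
    length (family k)                  ≡⟨ length-map (fromSeq ∘ fromPerm) (proj₁ (power k)) ⟩
    length (proj₁ (power k))           ≡⟨ proj₁ (proj₂ (power k)) ⟩
    length (map toSeq fam) ^ k         ≡⟨ cong (_^ k) (length-map toSeq fam) ⟩
    length fam ^ k                     ∎

  family-diff : ∀ k → AllPairs (GDifferent (G (T k))) (family k)
  family-diff k = AllPairs.map⁺ (AllPairs.map
    (λ {p} {q} c → fromSeq-clash (G (T k)) (fromPerm p) (fromPerm q)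
                     (fromPerm-clash (G (T k)) p q c))
    (proj₂ (proj₂ (power k))))

  N₀≤T : ∀ {k} → N₀ ≤ k → N₀ ≤ T k
  N₀≤T {k} N₀≤k = ≤-trans N₀≤k (≤-trans (m≤m*n k n)
    (≤-trans (m≤m+n (k * n) (n + b)) (≤-reflexive (sym (T-closed k)))))

-- Bounds on F₀(G N) for all large N bound F_b(G n) for all n ≥ 1 and all b.
-- A negative rate is impossible, as F₀ ≥ 1.
blank-bound : (G : (n : ℕ) → Graph n)
  (superadditive : ∀ n₁ n₂ → DisjUnionSubgraph (G (suc n₁)) (G (suc n₂)) (G (suc n₁ + suc n₂)))
  (N₀ : ℕ) (r : ℚᵘ) → (∀ N → N₀ ≤ N → FbBelow (G N) 0 r) →
  ∀ n′ b → FbBelow (G (suc n′)) b r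
blank-bound G superadditive N₀ (mkℚᵘ (ℤ+ A) D′) below =
  blank-bound⁺ G superadditive N₀ A D′ below
blank-bound G superadditive N₀ (mkℚᵘ -[1+ e ] D′) below n′ b =
  ⊥-elim (no-negative-rate (suc D′) (N₀ + e * suc N₀)
    (below (suc N₀) (n≤1+n N₀) (fromSeq (fromPerm (identity (suc N₀))) ∷ []) ([] ∷ [])))

ρ≤⇒ρ∞≤ : (G : (n : ℕ) → Graph n) →
  (∀ n₁ n₂ → DisjUnionSubgraph (G (suc n₁)) (G (suc n₂)) (G (suc n₁ + suc n₂))) →
  ∀ q → ρ≤ G q → ρ∞≤ G q
ρ≤⇒ρ∞≤ G superadditive q ρ≤q r q<r with N₀ , below ← ρ≤q r q<r =
  1 , λ { (suc n′) _ b → blank-bound G superadditive N₀ r below n′ b }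

ρ∞≤⇒ρ≤ : (G : (n : ℕ) → Graph n) → ∀ q → ρ∞≤ G q → ρ≤ G q
ρ∞≤⇒ρ≤ G q ρ∞≤q r q<r with N , below ← ρ∞≤q r q<r = N , λ n N≤n → below n N≤n 0

lemma4 : (G : (n : ℕ) → Graph n)
    → (∀ n₁ n₂ → DisjUnionSubgraph (G (suc n₁)) (G (suc n₂)) (G (suc n₁ + suc n₂)))
    → ρFinite G ⊎ ρ∞Finite G
    → ρFinite G × ρ∞Finite G × (∀ q → ρ≤ G q ⇔ ρ∞≤ G q)
lemma4 G superadditive finite = ρ-finite finite , ρ∞-finite finite , same-bounds
  where
  same-bounds : ∀ q → ρ≤ G q ⇔ ρ∞≤ G q
  same-bounds q = mk⇔ (ρ≤⇒ρ∞≤ G superadditive q) (ρ∞≤⇒ρ≤ G q)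
  ρ-finite : ρFinite G ⊎ ρ∞Finite G → ρFinite G
  ρ-finite (inj₁ ρ-fin)        = ρ-fin
  ρ-finite (inj₂ (q , ρ∞≤q))   = q , ρ∞≤⇒ρ≤ G q ρ∞≤q
  ρ∞-finite : ρFinite G ⊎ ρ∞Finite G → ρ∞Finite G
  ρ∞-finite (inj₁ (q , ρ≤q))   = q , ρ≤⇒ρ∞≤ G superadditive q ρ≤q
  ρ∞-finite (inj₂ ρ∞-fin)      = ρ∞-fin
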